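{- Let $t, r$ be integers with $t \ge r \ge 1$ and let $n = 2(t-r+1)$. Then the $(t,r)$ broadcast domination number of the cycle graph $C_n$ on $n$ vertices is $\gamma_{t,r}(C_n) = 2$.
   Context: Let $G=(V,E)$ be a graph and fix integers $t \ge r \ge 1$. For $D \subseteq V$ and $v \in V$, the reception at $v$ is $r(v) = \sum_{u \in D,\ \mathrm{dist}(u,v) \le t} (t - \mathrm{dist}(u,v))$, where $\mathrm{dist}$ is graph distance. $D$ is a $(t,r)$ broadcast dominating set if $r(v) \ge r$ for every $v \in V$. The $(t,r)$ broadcast domination number $\gamma_{t,r}(G)$ is the minimum cardinality of a $(t,r)$ broadcast dominating set of $G$. $C_n$ denotes the cycle on $n$ vertices (when $n=2$, i.e. $t=r$, it is understood as two vertices joined by an edge). -}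

module Defs where

open import Data.Nat using (ℕ; _+_; _∸_; _≤_; _⊓_)
open import Data.Nat.ListAction using (sum)
open import Data.Bool using (if_then_else_)
open import Data.Fin using (Fin; toℕ)
open import Data.Fin.Subset using (Subset; ∣_∣)
open import Data.Vec using (lookup)
open import Data.List using (List; map)
open import Data.List using () renaming (allFin to allFinL)
open import Data.Product using (Σ; _×_)
open import Relation.Binary.PropositionalEquality using (_≡_)

-- Graph distance in the cycle C_n on vertex set Fin n (vertex i adjacent to i±1 mod n):
-- dist(i,j) = min(|i-j|, n-|i-j|).  For n = 2 this is the single edge (distance 1).
absDiff : ℕ → ℕ → ℕ
absDiff a b = (a ∸ b) + (b ∸ a)

cycleDist : (n : ℕ) → Fin n → Fin n → ℕ
cycleDist n i j = absDiff (toℕ i) (toℕ j) ⊓ (n ∸ absDiff (toℕ i) (toℕ j))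

-- reception at v from broadcast set D: Σ_{u ∈ D, dist(u,v) ≤ t} (t - dist(u,v)).
-- (Terms with dist > t contribute t ∸ dist = 0, so truncated subtraction is exact.)
reception : (t n : ℕ) → Subset n → Fin n → ℕ
reception t n D v =
  sum (map (λ u → if lookup D u then t ∸ cycleDist n u v else 0) (allFinL n))

IsBroadcastDominating : (t r n : ℕ) → Subset n → Set
IsBroadcastDominating t r n D = ∀ (v : Fin n) → r ≤ reception t n D v

IsBroadcastDominationNumber : (t r n : ℕ) → ℕ → Set
IsBroadcastDominationNumber t r n k =
  Σ (Subset n) (λ D → IsBroadcastDominating t r n D × ∣ D ∣ ≡ k)
  × (∀ (D : Subset n) → IsBroadcastDominating t r n D → k ≤ ∣ D ∣)

{-# OPTIONS --safe #-}
module Submission where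

-- The antipodal pair {0, m} in C_{2m}, where m = t - r + 1, is a (t,r) broadcast
-- dominating set: every vertex lies within distance m - 1 = t - r of one of the
-- two, and so receives at least r from it. No set of at most one vertex works:
-- the antipode of that vertex is at distance m and receives only t - m = r - 1.

open import Defs
open import Data.Nat using (ℕ; zero; suc; pred; _+_; _*_; _∸_; _≤_; _<_; ∣_-_∣; z≤n; s≤s⁻¹)
open import Data.Nat.Properties
open import Data.Nat.ListAction using (sum)
open import Data.Bool using (if_then_else_)
open import Data.Fin using (Fin; zero; suc; toℕ; _↑ˡ_; _↑ʳ_; splitAt; join)
open import Data.Fin.Properties using (toℕ<n; toℕ-↑ˡ; toℕ-↑ʳ; join-splitAt)
open import Data.Fin.Subset using (Subset; ∣_∣; _∈_; ⁅_⁆; inside; outside)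
open import Data.Fin.Subset.Properties using (∣⁅x⁆∣≡1; ∣p∣≤∣x∷p∣; x∈p⇒∣p-x∣<∣p∣; nonempty?)
open import Data.Vec using (_∷_; []; _++_; lookup; here; there)
open import Data.List using (map; allFin)
open import Data.List.Properties using (map-tabulate)
open import Data.Product using (_×_; _,_; ∃-syntax)
open import Data.Sum using ([_,_])
open import Function using (id; _∘_)
open import Relation.Nullary using (¬_; yes; no; contradiction)
open import Relation.Binary.PropositionalEquality using (_≡_; refl; sym; trans; cong; cong₂; subst)

sumOver : ∀ {n} → Subset n → (Fin n → ℕ) → ℕ
sumOver {n} D f = sum (map (λ u → if lookup D u then f u else 0) (allFin n))

sumOver-∷ : ∀ {n} b (D : Subset n) (f : Fin (suc n) → ℕ) →
            sumOver (b ∷ D) f ≡ (if b then f zero else 0) + sumOver D (f ∘ suc)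
sumOver-∷ b D f = cong (_ +_) (cong sum (trans (map-tabulate suc g) (sym (map-tabulate id (g ∘ suc)))))
  where
  g : Fin (suc _) → ℕ
  g u = if lookup (b ∷ D) u then f u else 0

∈⇒≤sumOver : ∀ {n} {D : Subset n} {x} (f : Fin n → ℕ) → x ∈ D → f x ≤ sumOver D f
∈⇒≤sumOver {D = inside ∷ D} f here
  rewrite sumOver-∷ inside D f = m≤m+n (f zero) _
∈⇒≤sumOver {D = b ∷ D} f (there x∈D)
  rewrite sumOver-∷ b D f = ≤-trans (∈⇒≤sumOver (f ∘ suc) x∈D) (m≤n+m _ _)

sumOver≤∣D∣* : ∀ {n} (D : Subset n) (f : Fin n → ℕ) {c} →
               (∀ {x} → x ∈ D → f x ≤ c) → sumOver D f ≤ ∣ D ∣ * c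
sumOver≤∣D∣* [] f bounded = z≤n
sumOver≤∣D∣* (inside ∷ D) f bounded rewrite sumOver-∷ inside D f =
  +-mono-≤ (bounded here) (sumOver≤∣D∣* D (f ∘ suc) (bounded ∘ there))
sumOver≤∣D∣* (outside ∷ D) f bounded rewrite sumOver-∷ outside D f =
  sumOver≤∣D∣* D (f ∘ suc) (bounded ∘ there)

∣p∣≤1⇒∈-unique : ∀ {n} {p : Subset n} {x y} → ∣ p ∣ ≤ 1 → x ∈ p → y ∈ p → x ≡ y
∣p∣≤1⇒∈-unique _ here here = refl
∣p∣≤1⇒∈-unique ∣p∣≤1 here (there y∈p) =
  contradiction (≤-<-trans z≤n (x∈p⇒∣p-x∣<∣p∣ y∈p)) (≤⇒≯ (s≤s⁻¹ ∣p∣≤1))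
∣p∣≤1⇒∈-unique ∣p∣≤1 (there x∈p) here = sym (∣p∣≤1⇒∈-unique ∣p∣≤1 here (there x∈p))
∣p∣≤1⇒∈-unique {p = b ∷ p} ∣p∣≤1 (there x∈p) (there y∈p) =
  cong suc (∣p∣≤1⇒∈-unique (≤-trans (∣p∣≤∣x∷p∣ b p) ∣p∣≤1) x∈p y∈p)

∣p++q∣≡∣p∣+∣q∣ : ∀ {m n} (p : Subset m) (q : Subset n) → ∣ p ++ q ∣ ≡ ∣ p ∣ + ∣ q ∣
∣p++q∣≡∣p∣+∣q∣ [] q = refl
∣p++q∣≡∣p∣+∣q∣ (inside ∷ p) q = cong suc (∣p++q∣≡∣p∣+∣q∣ p q)
∣p++q∣≡∣p∣+∣q∣ (outside ∷ p) q = ∣p++q∣≡∣p∣+∣q∣ p q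

∈-++⁺ʳ : ∀ {m n} (p : Subset m) {q : Subset n} {x} → x ∈ q → m ↑ʳ x ∈ p ++ q
∈-++⁺ʳ [] x∈q = x∈q
∈-++⁺ʳ (b ∷ p) x∈q = there (∈-++⁺ʳ p x∈q)

↑ˡ↑ʳ-elim : ∀ {m n} (P : Fin (m + n) → Set) →
            (∀ i → P (i ↑ˡ n)) → (∀ j → P (m ↑ʳ j)) → ∀ u → P u
↑ˡ↑ʳ-elim {m} {n} P left right u =
  subst P (join-splitAt m n u) ([_,_] {C = P ∘ join m n} left right (splitAt m u))

absDiff≡∣-∣ : ∀ a b → absDiff a b ≡ ∣ a - b ∣
absDiff≡∣-∣ zero zero = refl
absDiff≡∣-∣ zero (suc b) = refl
absDiff≡∣-∣ (suc a) zero = +-identityʳ (suc a)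
absDiff≡∣-∣ (suc a) (suc b) = absDiff≡∣-∣ a b

cycleDist≤∣-∣ : ∀ n (i j : Fin n) → cycleDist n i j ≤ ∣ toℕ i - toℕ j ∣
cycleDist≤∣-∣ n i j = ≤-trans (m⊓n≤m _ _) (≤-reflexive (absDiff≡∣-∣ (toℕ i) (toℕ j)))

cycleDist-antipodal : ∀ m (i j : Fin (m + m)) → ∣ toℕ i - toℕ j ∣ ≡ m → cycleDist (m + m) i j ≡ m
cycleDist-antipodal m i j ∣i-j∣≡m
  rewrite absDiff≡∣-∣ (toℕ i) (toℕ j) | ∣i-j∣≡m | m+n∸m≡n m m = ⊓-idem m

∣m+n-n∣≡m : ∀ m n → ∣ m + n - n ∣ ≡ m
∣m+n-n∣≡m m n = trans (m≤n⇒∣n-m∣≡n∸m (m≤n+m n m)) (m+n∸n≡m m n)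

antipode : ∀ m (u : Fin (m + m)) → ∃[ w ] ∣ toℕ u - toℕ w ∣ ≡ m
antipode m = ↑ˡ↑ʳ-elim _ (λ i → m ↑ʳ i , left i) (λ j → j ↑ˡ m , right j)
  where
  left : ∀ i → ∣ toℕ (i ↑ˡ m) - toℕ (m ↑ʳ i) ∣ ≡ m
  left i rewrite toℕ-↑ˡ i m | toℕ-↑ʳ m i = trans (∣-∣-comm (toℕ i) _) (∣m+n-n∣≡m m (toℕ i))
  right : ∀ j → ∣ toℕ (m ↑ʳ j) - toℕ (j ↑ˡ m) ∣ ≡ m
  right j rewrite toℕ-↑ˡ j m | toℕ-↑ʳ m j = ∣m+n-n∣≡m m (toℕ j)

poles : ∀ k → Subset (suc k + suc k)
poles k = ⁅ zero ⁆ ++ ⁅ zero ⁆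

∣poles∣≡2 : ∀ k → ∣ poles k ∣ ≡ 2
∣poles∣≡2 k = trans (∣p++q∣≡∣p∣+∣q∣ ⁅ zero {k} ⁆ ⁅ zero {k} ⁆)
                    (cong₂ _+_ (∣⁅x⁆∣≡1 (zero {k})) (∣⁅x⁆∣≡1 (zero {k})))

near-pole : ∀ k (v : Fin (suc k + suc k)) → ∃[ u ] u ∈ poles k × ∣ toℕ u - toℕ v ∣ ≤ k
near-pole k = ↑ˡ↑ʳ-elim _ (λ i → zero , here , left i)
                          (λ j → suc k ↑ʳ zero , ∈-++⁺ʳ ⁅ zero ⁆ here , right j)
  where
  left : ∀ i → toℕ (i ↑ˡ suc k) ≤ k
  left i rewrite toℕ-↑ˡ i (suc k) = s≤s⁻¹ (toℕ<n i)
  right : (j : Fin (suc k)) → ∣ toℕ (suc k ↑ʳ zero {k}) - toℕ (suc k ↑ʳ j) ∣ ≤ k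
  right j = ≤-trans (≤-reflexive ∣m+0-m+j∣≡j) (s≤s⁻¹ (toℕ<n j))
    where
    ∣m+0-m+j∣≡j : ∣ toℕ (suc k ↑ʳ zero {k}) - toℕ (suc k ↑ʳ j) ∣ ≡ toℕ j
    ∣m+0-m+j∣≡j = trans (cong₂ ∣_-_∣ (toℕ-↑ʳ (suc k) zero) (toℕ-↑ʳ (suc k) j))
                        (∣m+n-m+o∣≡∣n-o∣ (suc k) 0 (toℕ j))

poles-dominating : ∀ k {t r} → k + r ≤ t → IsBroadcastDominating t r (suc k + suc k) (poles k)
poles-dominating k {t} {r} k+r≤t v with near-pole k v
... | u , u∈poles , close = begin
  r                     ≡⟨ m+n∸m≡n k r ⟨
  k + r ∸ k             ≤⟨ ∸-monoˡ-≤ k k+r≤t ⟩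
  t ∸ k                 ≤⟨ ∸-monoʳ-≤ t (≤-trans (cycleDist≤∣-∣ n u v) close) ⟩
  t ∸ cycleDist n u v   ≤⟨ ∈⇒≤sumOver (λ w → t ∸ cycleDist n w v) u∈poles ⟩
  reception t n (poles k) v ∎
  where
  open ≤-Reasoning
  n : ℕ
  n = suc k + suc k

far-vertex : ∀ k {D : Subset (suc k + suc k)} → ∣ D ∣ ≤ 1 →
             ∃[ v ] ∀ {u} → u ∈ D → suc k ≤ cycleDist (suc k + suc k) u v
far-vertex k {D} ∣D∣≤1 with nonempty? D
... | no empty = zero , λ u∈D → contradiction (_ , u∈D) empty
... | yes (u , u∈D) with antipode (suc k) u
...   | v , ∣u-v∣≡m = v , far
  where
  far : ∀ {x} → x ∈ D → suc k ≤ cycleDist (suc k + suc k) x v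
  far x∈D with ∣p∣≤1⇒∈-unique ∣D∣≤1 x∈D u∈D
  ... | refl = ≤-reflexive (sym (cycleDist-antipodal (suc k) u v ∣u-v∣≡m))

small-not-dominating : ∀ k {t r} {D : Subset (suc k + suc k)} →
                       t ∸ suc k < r → ∣ D ∣ ≤ 1 → ¬ IsBroadcastDominating t r (suc k + suc k) D
small-not-dominating k {t} {r} {D} t∸m<r ∣D∣≤1 dominating with far-vertex k ∣D∣≤1
... | v , far = <⇒≱ weak (dominating v)
  where
  open ≤-Reasoning
  weak : reception t (suc k + suc k) D v < r
  weak = begin-strict
    reception t (suc k + suc k) D v ≤⟨ sumOver≤∣D∣* D _ (∸-monoʳ-≤ t ∘ far) ⟩
    ∣ D ∣ * (t ∸ suc k)             ≤⟨ *-monoˡ-≤ (t ∸ suc k) ∣D∣≤1 ⟩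
    1 * (t ∸ suc k)                 ≡⟨ *-identityˡ (t ∸ suc k) ⟩
    t ∸ suc k                       <⟨ t∸m<r ⟩
    r                               ∎

lemma1 : (t r : ℕ) → 1 ≤ r → r ≤ t →
    IsBroadcastDominationNumber t r (2 * suc (t ∸ r)) 2
lemma1 t zero () _
lemma1 t (suc r) _ r<t =
  subst (λ n → IsBroadcastDominationNumber t (suc r) n 2) (cong (m +_) (sym (+-identityʳ m)))
    ((poles k , poles-dominating k (≤-reflexive (m∸n+n≡m r<t)) , ∣poles∣≡2 k) , minimal)
  where
  k m : ℕ
  k = t ∸ suc r
  m = suc k
  t∸m≡r : t ∸ m ≡ r
  t∸m≡r = trans (sym (pred[m∸n]≡m∸[1+n] t k)) (cong pred (m∸[m∸n]≡n r<t))
  t∸m<r : t ∸ m < suc r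
  t∸m<r = ≤-reflexive (cong suc t∸m≡r)
  minimal : ∀ D → IsBroadcastDominating t (suc r) (m + m) D → 2 ≤ ∣ D ∣
  minimal D dominating = ≮⇒≥ λ ∣D∣<2 → small-not-dominating k {D = D} t∸m<r (s≤s⁻¹ ∣D∣<2) dominating
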